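{- If $\mathbf A \in \mathcal A_{10}$, then $\mathbf A$ satisfies: (a) $[0 \to (x \to y)]' \approx x \to y'$; (b) $(y \to x)'' \approx x \to y'$; (c) $(x \to y)' \approx x \to y'$.
   Context: An $\mathcal I$-zroupoid is an algebra $\langle A,\to,0\rangle$ ($\to$ binary, $0$ constant) satisfying $(x \to y) \to z \approx [(z' \to x) \to (y \to z)']'$ and $0''\approx 0$, where $x' := x \to 0$ (prime binds tighter than $\to$); $\mathcal I$ is their variety. $\mathcal A_{10}$ is the subvariety of $\mathcal I$ defined by $x \to (y \to z) \approx (z \to y) \to x$. -}

module Defs where

open import Level using (Level; suc)
open import Relation.Binary.PropositionalEquality using (_≡_)
open import Data.Product using (_×_)

record ZAlgebra (a : Level) : Set (suc a) where
  field
    Carrier : Set a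
    _⇒_     : Carrier → Carrier → Carrier
    𝟘       : Carrier

  infixr 5 _⇒_

  _′ : Carrier → Carrier
  x ′ = x ⇒ 𝟘

  infix 8 _′

IsIZroupoid : ∀ {a} → ZAlgebra a → Set a
IsIZroupoid A =
  (∀ x y z → (x ⇒ y) ⇒ z ≡ (((z ′ ⇒ x) ⇒ (y ⇒ z) ′) ′))
  × (𝟘 ′ ′ ≡ 𝟘)
  where open ZAlgebra A

IsA10 : ∀ {a} → ZAlgebra a → Set a
IsA10 A = IsIZroupoid A × (∀ x y z → x ⇒ (y ⇒ z) ≡ (z ⇒ y) ⇒ x)
  where open ZAlgebra A

-- By the flip law x → (y → z) = (z → y) → x, the element 0 → x is x', primes commute
-- past everything, and (x → y)' = (y → x)'.  Feeding this into the zroupoid law gives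
-- 0' = 0 and then that priming is idempotent.  Since the zroupoid law writes every
-- (u → v) → w as a prime, all such elements are fixed by priming; x → y' = y' → x is
-- one of them, and the zroupoid law at z = 0 rewrites (x → y)' as (x → y')'.

module Submission where

open import Defs
open import Level using (Level)
open import Relation.Binary.PropositionalEquality
  using (_≡_; sym; trans; cong; cong₂; module ≡-Reasoning)
open import Data.Product using (_×_; _,_; proj₁; proj₂)

module A10-Properties {a : Level} (A : ZAlgebra a) (isA10 : IsA10 A) where
  open ZAlgebra A
  open ≡-Reasoning

  zroupoid-law : ∀ x y z → (x ⇒ y) ⇒ z ≡ ((z ′ ⇒ x) ⇒ (y ⇒ z) ′) ′
  zroupoid-law = proj₁ (proj₁ isA10)

  𝟘′′≡𝟘 : 𝟘 ′ ′ ≡ 𝟘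
  𝟘′′≡𝟘 = proj₂ (proj₁ isA10)

  ⇒-flip : ∀ x y z → x ⇒ (y ⇒ z) ≡ (z ⇒ y) ⇒ x
  ⇒-flip = proj₂ isA10

  𝟘⇒𝟘′≡𝟘 : 𝟘 ⇒ 𝟘 ′ ≡ 𝟘
  𝟘⇒𝟘′≡𝟘 = trans (⇒-flip 𝟘 𝟘 𝟘) 𝟘′′≡𝟘

  𝟘⇒x≡x′ : ∀ x → 𝟘 ⇒ x ≡ x ′
  𝟘⇒x≡x′ x = begin
    𝟘 ⇒ x          ≡⟨ cong (_⇒ x) 𝟘⇒𝟘′≡𝟘 ⟨
    (𝟘 ⇒ 𝟘 ′) ⇒ x  ≡⟨ ⇒-flip x (𝟘 ′) 𝟘 ⟨
    x ⇒ 𝟘 ′ ′      ≡⟨ cong (x ⇒_) 𝟘′′≡𝟘 ⟩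
    x ′            ∎

  x⇒y′≡y′⇒x : ∀ x y → x ⇒ y ′ ≡ y ′ ⇒ x
  x⇒y′≡y′⇒x x y = trans (⇒-flip x y 𝟘) (cong (_⇒ x) (𝟘⇒x≡x′ y))

  [x⇒y]′≡[y⇒x]′ : ∀ x y → (x ⇒ y) ′ ≡ (y ⇒ x) ′
  [x⇒y]′≡[y⇒x]′ x y = trans (sym (𝟘⇒x≡x′ (x ⇒ y))) (⇒-flip 𝟘 x y)

  [x′⇒x]⇒y≡[y′⇒y]⇒x : ∀ x y → (x ′ ⇒ x) ⇒ y ≡ (y ′ ⇒ y) ⇒ x
  [x′⇒x]⇒y≡[y′⇒y]⇒x x y = begin
    (x ′ ⇒ x) ⇒ y                       ≡⟨ zroupoid-law (x ′) x y ⟩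
    ((y ′ ⇒ x ′) ⇒ (x ⇒ y) ′) ′         ≡⟨ cong₂ (λ u v → (u ⇒ v) ′)
                                             (x⇒y′≡y′⇒x (x ′) y) ([x⇒y]′≡[y⇒x]′ y x) ⟨
    ((x ′ ⇒ y ′) ⇒ (y ⇒ x) ′) ′         ≡⟨ zroupoid-law (y ′) y x ⟨
    (y ′ ⇒ y) ⇒ x                       ∎

  [x′⇒x]′≡x′ : ∀ x → (x ′ ⇒ x) ′ ≡ x ′
  [x′⇒x]′≡x′ x = begin
    (x ′ ⇒ x) ′    ≡⟨ [x′⇒x]⇒y≡[y′⇒y]⇒x x 𝟘 ⟩
    𝟘 ′ ′ ⇒ x      ≡⟨ cong (_⇒ x) 𝟘′′≡𝟘 ⟩
    𝟘 ⇒ x          ≡⟨ 𝟘⇒x≡x′ x ⟩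
    x ′            ∎

  𝟘′≡𝟘 : 𝟘 ′ ≡ 𝟘
  𝟘′≡𝟘 = begin
    𝟘 ′                  ≡⟨ cong _′ 𝟘⇒𝟘′≡𝟘 ⟨
    (𝟘 ⇒ 𝟘 ′) ′          ≡⟨ cong (λ u → (u ⇒ 𝟘 ′) ′) 𝟘′′≡𝟘 ⟨
    (𝟘 ′ ′ ⇒ 𝟘 ′) ′      ≡⟨ [x′⇒x]′≡x′ (𝟘 ′) ⟩
    𝟘 ′ ′                ≡⟨ 𝟘′′≡𝟘 ⟩
    𝟘                    ∎

  [x⇒y]′≡[x′⇒y′′]′ : ∀ x y → (x ⇒ y) ′ ≡ (x ′ ⇒ y ′ ′) ′
  [x⇒y]′≡[x′⇒y′′]′ x y = begin
    (x ⇒ y) ′                ≡⟨ zroupoid-law x y 𝟘 ⟩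
    ((𝟘 ′ ⇒ x) ⇒ y ′ ′) ′    ≡⟨ cong (λ u → ((u ⇒ x) ⇒ y ′ ′) ′) 𝟘′≡𝟘 ⟩
    ((𝟘 ⇒ x) ⇒ y ′ ′) ′      ≡⟨ cong (λ u → (u ⇒ y ′ ′) ′) (𝟘⇒x≡x′ x) ⟩
    (x ′ ⇒ y ′ ′) ′          ∎

  [x⇒x]′≡x′′ : ∀ x → (x ⇒ x) ′ ≡ x ′ ′
  [x⇒x]′≡x′′ x = begin
    (x ⇒ x) ′            ≡⟨ [x⇒y]′≡[x′⇒y′′]′ x x ⟩
    (x ′ ⇒ x ′ ′) ′      ≡⟨ [x⇒y]′≡[y⇒x]′ (x ′) (x ′ ′) ⟩
    (x ′ ′ ⇒ x ′) ′      ≡⟨ [x′⇒x]′≡x′ (x ′) ⟩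
    x ′ ′                ∎

  x′′′≡x′′ : ∀ x → x ′ ′ ′ ≡ x ′ ′
  x′′′≡x′′ x = sym (begin
    x ′ ′                ≡⟨ [x⇒y]′≡[x′⇒y′′]′ x 𝟘 ⟩
    (x ′ ⇒ 𝟘 ′ ′) ′      ≡⟨ cong (λ u → (x ′ ⇒ u) ′) 𝟘′′≡𝟘 ⟩
    x ′ ′ ′              ∎)

  x′′≡x′ : ∀ x → x ′ ′ ≡ x ′
  x′′≡x′ x = begin
    x ′ ′                    ≡⟨ x′′′≡x′′ x ⟨
    x ′ ′ ′                  ≡⟨ x′′′≡x′′ (x ′) ⟨
    x ′ ′ ′ ′                ≡⟨ [x⇒x]′≡x′′ (x ′ ′) ⟨
    (x ′ ′ ⇒ x ′ ′) ′        ≡⟨ [x⇒y]′≡[x′⇒y′′]′ (x ′) x ⟨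
    (x ′ ⇒ x) ′              ≡⟨ [x′⇒x]′≡x′ x ⟩
    x ′                      ∎

  [[x⇒y]⇒z]′≡[x⇒y]⇒z : ∀ x y z → ((x ⇒ y) ⇒ z) ′ ≡ (x ⇒ y) ⇒ z
  [[x⇒y]⇒z]′≡[x⇒y]⇒z x y z = begin
    ((x ⇒ y) ⇒ z) ′    ≡⟨ cong _′ (zroupoid-law x y z) ⟩
    w ′ ′              ≡⟨ x′′≡x′ w ⟩
    w ′                ≡⟨ zroupoid-law x y z ⟨
    (x ⇒ y) ⇒ z        ∎
    where w = (z ′ ⇒ x) ⇒ (y ⇒ z) ′

  x′⇒x≡x′ : ∀ x → x ′ ⇒ x ≡ x ′
  x′⇒x≡x′ x = trans (sym ([[x⇒y]⇒z]′≡[x⇒y]⇒z x 𝟘 x)) ([x′⇒x]′≡x′ x)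

  x′⇒y≡x⇒y′ : ∀ x y → x ′ ⇒ y ≡ x ⇒ y ′
  x′⇒y≡x⇒y′ x y = begin
    x ′ ⇒ y              ≡⟨ cong (_⇒ y) (x′⇒x≡x′ x) ⟨
    (x ′ ⇒ x) ⇒ y        ≡⟨ [x′⇒x]⇒y≡[y′⇒y]⇒x x y ⟩
    (y ′ ⇒ y) ⇒ x        ≡⟨ cong (_⇒ x) (x′⇒x≡x′ y) ⟩
    y ′ ⇒ x              ≡⟨ x⇒y′≡y′⇒x x y ⟨
    x ⇒ y ′              ∎

  [x⇒y′]′≡x⇒y′ : ∀ x y → (x ⇒ y ′) ′ ≡ x ⇒ y ′
  [x⇒y′]′≡x⇒y′ x y = begin
    (x ⇒ y ′) ′          ≡⟨ cong _′ (x⇒y′≡y′⇒x x y) ⟩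
    (y ′ ⇒ x) ′          ≡⟨ [[x⇒y]⇒z]′≡[x⇒y]⇒z y 𝟘 x ⟩
    y ′ ⇒ x              ≡⟨ x⇒y′≡y′⇒x x y ⟨
    x ⇒ y ′              ∎

  [x⇒y]′≡x⇒y′ : ∀ x y → (x ⇒ y) ′ ≡ x ⇒ y ′
  [x⇒y]′≡x⇒y′ x y = begin
    (x ⇒ y) ′            ≡⟨ [x⇒y]′≡[x′⇒y′′]′ x y ⟩
    (x ′ ⇒ y ′ ′) ′      ≡⟨ cong (λ u → (x ′ ⇒ u) ′) (x′′≡x′ y) ⟩
    (x ′ ⇒ y ′) ′        ≡⟨ cong _′ (x′⇒y≡x⇒y′ x (y ′)) ⟩
    (x ⇒ y ′ ′) ′        ≡⟨ cong (λ u → (x ⇒ u) ′) (x′′≡x′ y) ⟩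
    (x ⇒ y ′) ′          ≡⟨ [x⇒y′]′≡x⇒y′ x y ⟩
    x ⇒ y ′              ∎

lemma3p10 : ∀ {a : Level} (A : ZAlgebra a) → IsA10 A →
    let open ZAlgebra A in
    (∀ x y → (𝟘 ⇒ (x ⇒ y)) ′ ≡ x ⇒ y ′)
    × (∀ x y → (y ⇒ x) ′ ′ ≡ x ⇒ y ′)
    × (∀ x y → (x ⇒ y) ′ ≡ x ⇒ y ′)
lemma3p10 A isA10 = part-a , part-b , [x⇒y]′≡x⇒y′
  where
  open ZAlgebra A
  open A10-Properties A isA10

  part-a : ∀ x y → (𝟘 ⇒ (x ⇒ y)) ′ ≡ x ⇒ y ′
  part-a x y = trans (cong _′ (𝟘⇒x≡x′ (x ⇒ y)))
                     (trans (x′′≡x′ (x ⇒ y)) ([x⇒y]′≡x⇒y′ x y))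

  part-b : ∀ x y → (y ⇒ x) ′ ′ ≡ x ⇒ y ′
  part-b x y = trans (x′′≡x′ (y ⇒ x))
                     (trans ([x⇒y]′≡[y⇒x]′ y x) ([x⇒y]′≡x⇒y′ x y))
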